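{- The series $g(x)=\sum_{n\ge 1}\frac{2\,(4n+1)!}{(n+1)!\,(3n+2)!}\,x^n$ converges at $x=\frac{27}{256}$, and $$g\!\left(\tfrac{27}{256}\right)=\sum_{n\ge 1}\frac{2\,(4n+1)!}{(n+1)!\,(3n+2)!}\left(\frac{27}{256}\right)^n=\frac{5}{27}.$$ -}

module Defs where

open import Data.Nat using (ℕ; zero; suc; _≥_; _!) renaming (_*_ to _*ℕ_; _+_ to _+ℕ_)
open import Data.Nat.Properties using (_!*_!≢0)
open import Data.Integer using (+_)
open import Data.Rational using (ℚ; 0ℚ; 1ℚ; _+_; _*_; _-_; ∣_∣; _<_; _/_)
open import Data.Product using (∃-syntax)

_^ℚ_ : ℚ → ℕ → ℚ
q ^ℚ zero = 1ℚ
q ^ℚ suc n = q * (q ^ℚ n)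

coeff : ℕ → ℚ
coeff n = (+ (2 *ℕ ((4 *ℕ n +ℕ 1) !))) / ((n +ℕ 1) ! *ℕ (3 *ℕ n +ℕ 2) !)
  where instance _ = (n +ℕ 1) !*(3 *ℕ n +ℕ 2) !≢0

x₀ : ℚ
x₀ = + 27 / 256

partialSum : ℚ → ℕ → ℚ
partialSum x zero = 0ℚ
partialSum x (suc N) = partialSum x N + coeff (suc N) * (x ^ℚ suc N)

ConvergesTo : (ℕ → ℚ) → ℚ → Set
ConvergesTo S L = ∀ (ε : ℚ) → 0ℚ < ε → ∃[ N ] (∀ m → m ≥ N → ∣ S m - L ∣ < ε)

{-# OPTIONS --safe #-}
module Submission where

-- forests y n counts ordered forests of y quaternary trees with n internal nodes, i.e. it is the
-- coefficient of xⁿ in B(x)ʸ where B = 1 + x B⁴; for y ≥ 1 it equals y (4n+y−1)! / (n! (3n+y)!),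
-- which makes the n-th coefficient of g equal to 2 forests 2 n − forests 3 n. At x₀ = α β³
-- (α = 1/4, β = 3/4) the weights forests y n · x₀ⁿ · βʸ form the law of the number of internal
-- nodes of a critical Galton–Watson forest of y trees (a node has four children with probability α),
-- so they sum to 1, i.e. B(x₀) = 1/β, and g(x₀) = 2 (4/3)² − (4/3)³ − 1 = 5/27. For the rate, the
-- tail mass tail N y (at least N internal nodes) obeys the first-step recursion
-- tail (N+1) (y+1) = β tail (N+1) y + α tail N (y+4), which gives tail N y ≤ y δ + (1 − βᴹ)ᴺ
-- whenever M δ ≥ 1; Bernoulli's inequality makes the second term small.

open import Data.Product using (∃-syntax; _,_)
open import Relation.Binary.PropositionalEquality

open import Defs

module QuaternaryForests where
  open import Data.Nat
  open import Data.Nat.Properties using (*-identityˡ; *-cancelˡ-≡; +-suc; +-comm)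
  open import Data.Nat.Tactic.RingSolver using (solve-∀)
  open ≡-Reasoning

  forests : ℕ → ℕ → ℕ
  forests zero    zero    = 1
  forests zero    (suc n) = 0
  forests (suc y) zero    = 1
  forests (suc y) (suc n) = forests y (suc n) + forests (4 + y) n

  forests-zero : ∀ y → forests y 0 ≡ 1
  forests-zero zero    = refl
  forests-zero (suc y) = refl

  forests-closedForm : ∀ y n → forests (suc y) n * (n ! * (3 * n + suc y) !) ≡ suc y * (4 * n + y) !
  forests-closedForm y zero = trans (*-identityˡ _) (*-identityˡ _)
  forests-closedForm zero (suc n) = begin
    F * (suc n ! * (3 * suc n + 1) !)      ≡⟨ cong (λ k → F * (suc n ! * k !)) (3[1+n]+1≡3n+4 n) ⟩
    F * (suc n * n ! * (3 * n + 4) !)      ≡⟨ pull-out n F (n !) ((3 * n + 4) !) ⟩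
    suc n * (F * (n ! * (3 * n + 4) !))    ≡⟨ cong (suc n *_) (forests-closedForm 3 n) ⟩
    suc n * (4 * (4 * n + 3) !)            ≡⟨ regroup n ((4 * n + 3) !) ⟩
    1 * (suc (4 * n + 3) * (4 * n + 3) !)  ≡⟨ cong (λ k → 1 * k !) (4n+4≡4[1+n]+0 n) ⟩
    1 * (4 * suc n + 0) !                  ∎
    where
    F = forests 4 n
    3[1+n]+1≡3n+4 : ∀ n → 3 * suc n + 1 ≡ 3 * n + 4
    3[1+n]+1≡3n+4 = solve-∀
    pull-out : ∀ n F f g → F * (suc n * f * g) ≡ suc n * (F * (f * g))
    pull-out = solve-∀
    regroup : ∀ n h → suc n * (4 * h) ≡ 1 * (suc (4 * n + 3) * h)
    regroup = solve-∀
    4n+4≡4[1+n]+0 : ∀ n → suc (4 * n + 3) ≡ 4 * suc n + 0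
    4n+4≡4[1+n]+0 = solve-∀
  forests-closedForm (suc y) (suc n) = begin
    (F₁ + F₂) * (suc n ! * (3 * suc n + suc (suc y)) !)
      ≡⟨ cong (λ k → (F₁ + F₂) * (suc n ! * k !)) (+-suc (3 * suc n) (suc y)) ⟩
    (F₁ + F₂) * (suc n * n ! * (suc G * G !))
      ≡⟨ split F₁ F₂ n G (n !) (G !) ⟩
    suc G * (F₁ * (suc n ! * G !)) + suc n * (F₂ * (n ! * (suc G * G !)))
      ≡⟨ cong₂ (λ u v → suc G * u + suc n * v) (forests-closedForm y (suc n)) F₂-closed ⟩
    suc G * (suc y * A !) + suc n * ((5 + y) * A !)
      ≡⟨ combine n y (A !) ⟩
    suc (suc y) * (suc A * A !)
      ≡⟨ cong (λ k → suc (suc y) * k !) (+-suc (4 * suc n) y) ⟨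
    suc (suc y) * (4 * suc n + suc y) !    ∎
    where
    F₁ = forests (suc y) (suc n)
    F₂ = forests (5 + y) n
    G = 3 * suc n + suc y
    A = 4 * suc n + y
    split : ∀ F₁ F₂ n g f h → (F₁ + F₂) * (suc n * f * (suc g * h))
                              ≡ suc g * (F₁ * (suc n * f * h)) + suc n * (F₂ * (f * (suc g * h)))
    split = solve-∀
    3n+5+y≡1+G : ∀ n y → 3 * n + suc (4 + y) ≡ suc (3 * suc n + suc y)
    3n+5+y≡1+G = solve-∀
    4n+4+y≡A : ∀ n y → 4 * n + (4 + y) ≡ 4 * suc n + y
    4n+4+y≡A = solve-∀
    F₂-closed : F₂ * (n ! * (suc G * G !)) ≡ (5 + y) * A !
    F₂-closed = subst₂ (λ g a → F₂ * (n ! * g !) ≡ (5 + y) * a !) (3n+5+y≡1+G n y) (4n+4+y≡A n y)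
                  (forests-closedForm (4 + y) n)
    combine : ∀ n y a → suc (3 * suc n + suc y) * (suc y * a) + suc n * ((5 + y) * a)
                        ≡ suc (suc y) * (suc (4 * suc n + y) * a)
    combine = solve-∀

  coeff-numerator : ∀ n → forests 3 n * ((n + 1) ! * (3 * n + 2) !) + 2 * (4 * n + 1) !
                        ≡ 2 * forests 2 n * ((n + 1) ! * (3 * n + 2) !)
  coeff-numerator n rewrite +-comm n 1 = *-cancelˡ-≡ _ _ 3 (begin
    3 * (F₃ * (suc n * f * g) + 2 * h)       ≡⟨ expand F₃ n f g h ⟩
    F₃ * (f * (suc (3 * n + 2) * g)) + 6 * h ≡⟨ cong (_+ 6 * h) F₃-closed ⟩
    3 * (suc (4 * n + 1) * h) + 6 * h        ≡⟨ collect n h ⟩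
    3 * (2 * suc n * (2 * h))                ≡⟨ cong (λ k → 3 * (2 * suc n * k)) (forests-closedForm 1 n) ⟨
    3 * (2 * suc n * (F₂ * (f * g)))         ≡⟨ reassociate F₂ n f g ⟩
    3 * (2 * F₂ * (suc n * f * g))           ∎)
    where
    F₂ = forests 2 n
    F₃ = forests 3 n
    f = n !
    g = (3 * n + 2) !
    h = (4 * n + 1) !
    F₃-closed : F₃ * (f * (suc (3 * n + 2) * g)) ≡ 3 * (suc (4 * n + 1) * h)
    F₃-closed = subst₂ (λ a b → F₃ * (f * a !) ≡ 3 * b !) (+-suc (3 * n) 2) (+-suc (4 * n) 1)
                  (forests-closedForm 2 n)
    expand : ∀ F₃ n f g h → 3 * (F₃ * (suc n * f * g) + 2 * h) ≡ F₃ * (f * (suc (3 * n + 2) * g)) + 6 * h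
    expand = solve-∀
    collect : ∀ n h → 3 * (suc (4 * n + 1) * h) + 6 * h ≡ 3 * (2 * suc n * (2 * h))
    collect = solve-∀
    reassociate : ∀ F₂ n f g → 3 * (2 * suc n * (F₂ * (f * g))) ≡ 3 * (2 * F₂ * (suc n * f * g))
    reassociate = solve-∀

open QuaternaryForests using (forests; forests-zero; coeff-numerator)

open import Data.Nat as ℕ using (ℕ; zero; suc)
import Data.Nat.Properties as ℕ
import Data.Nat.Coprimality as Coprimality
open import Data.Integer as ℤ using (+_; -[1+_])
import Data.Integer.Properties as ℤ
import Data.Integer.Tactic.RingSolver as ℤ
open import Data.Rational
open import Data.Rational.Properties
open import Data.Rational.Solver using (module +-*-Solver)
open import Data.Rational.Unnormalised as ℚᵘ using (mkℚᵘ; *≡*; *≤*)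
import Data.Rational.Unnormalised.Properties as ℚᵘ
open import Data.Sum using (inj₁; inj₂)
open import Relation.Nullary.Decidable using (toWitness)
open +-*-Solver

-- Built from mkℚ rather than _/_ so that it computes for a variable argument.
fromℕ : ℕ → ℚ
fromℕ n = mkℚ (+ n) 0 (Coprimality.sym (Coprimality.1-coprimeTo n))

fromℕ-+ : ∀ m n → fromℕ (m ℕ.+ n) ≡ fromℕ m + fromℕ n
fromℕ-+ m n =
  toℚᵘ-injective (ℚᵘ.≃-trans (*≡* numerators) (ℚᵘ.≃-sym (toℚᵘ-homo-+ (fromℕ m) (fromℕ n))))
  where
  identity : ∀ i j → (i ℤ.+ j) ℤ.* + 1 ≡ (i ℤ.* + 1 ℤ.+ j ℤ.* + 1) ℤ.* + 1
  identity = ℤ.solve-∀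
  numerators : + (m ℕ.+ n) ℤ.* + 1 ≡ (+ m ℤ.* + 1 ℤ.+ + n ℤ.* + 1) ℤ.* + 1
  numerators = trans (cong (ℤ._* + 1) (ℤ.pos-+ m n)) (identity (+ m) (+ n))

fromℕ-* : ∀ m n → fromℕ (m ℕ.* n) ≡ fromℕ m * fromℕ n
fromℕ-* m n =
  toℚᵘ-injective (ℚᵘ.≃-trans (*≡* numerators) (ℚᵘ.≃-sym (toℚᵘ-homo-* (fromℕ m) (fromℕ n))))
  where
  identity : ∀ i j → (i ℤ.* j) ℤ.* (+ 1 ℤ.* + 1) ≡ (i ℤ.* j) ℤ.* + 1
  identity = ℤ.solve-∀
  numerators : + (m ℕ.* n) ℤ.* (+ 1 ℤ.* + 1) ≡ (+ m ℤ.* + n) ℤ.* + 1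
  numerators = trans (cong (ℤ._* (+ 1 ℤ.* + 1)) (ℤ.pos-* m n)) (identity (+ m) (+ n))

fromℕ-nonNeg : ∀ n → 0ℚ ≤ fromℕ n
fromℕ-nonNeg n = nonNegative⁻¹ (fromℕ n)

fromℕ-mono-≤ : ∀ {m n} → m ℕ.≤ n → fromℕ m ≤ fromℕ n
fromℕ-mono-≤ {m} {n} m≤n =
  *≤* (subst₂ ℤ._≤_ (sym (ℤ.*-identityʳ (+ m))) (sym (ℤ.*-identityʳ (+ n))) (ℤ.+≤+ m≤n))

/-as-difference : ∀ a b c d .{{_ : ℕ.NonZero d}} →
                  b ℕ.* d ℕ.+ a ≡ c ℕ.* d → + a / d ≡ fromℕ c - fromℕ b
/-as-difference a b c (suc d) eq = toℚᵘ-injective (begin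
  toℚᵘ (+ a / suc d)                        ≈⟨ toℚᵘ-fromℚᵘ (mkℚᵘ (+ a) d) ⟩
  mkℚᵘ (+ a) d                              ≈⟨ *≡* cross-multiplied ⟩
  toℚᵘ (fromℕ c) ℚᵘ.+ ℚᵘ.- toℚᵘ (fromℕ b)   ≈⟨ ℚᵘ.+-congʳ _ (toℚᵘ-homo‿- (fromℕ b)) ⟨
  toℚᵘ (fromℕ c) ℚᵘ.+ toℚᵘ (- fromℕ b)      ≈⟨ toℚᵘ-homo-+ (fromℕ c) (- fromℕ b) ⟨
  toℚᵘ (fromℕ c - fromℕ b)                  ∎)
  where
  open ℚᵘ.≃-Reasoning
  eqℤ : + b ℤ.* + suc d ℤ.+ + a ≡ + c ℤ.* + suc d
  eqℤ = trans (cong (ℤ._+ + a) (sym (ℤ.pos-* b (suc d))))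
          (trans (sym (ℤ.pos-+ (b ℕ.* suc d) a)) (trans (cong +_ eq) (ℤ.pos-* c (suc d))))
  isolate : ∀ i j k → i ℤ.* + 1 ≡ (j ℤ.* k ℤ.+ i) ℤ.- j ℤ.* k
  isolate = ℤ.solve-∀
  factor : ∀ j k l → l ℤ.* k ℤ.- j ℤ.* k ≡ (l ℤ.* + 1 ℤ.+ ℤ.- j ℤ.* + 1) ℤ.* k
  factor = ℤ.solve-∀
  cross-multiplied : + a ℤ.* + 1 ≡ (+ c ℤ.* + 1 ℤ.+ ℤ.- + b ℤ.* + 1) ℤ.* + suc d
  cross-multiplied = trans (isolate (+ a) (+ b) (+ suc d))
                       (trans (cong (ℤ._- + b ℤ.* + suc d) eqℤ) (factor (+ b) (+ suc d) (+ c)))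

*-nonNeg : ∀ {p q} → 0ℚ ≤ p → 0ℚ ≤ q → 0ℚ ≤ p * q
*-nonNeg {p} {q} p≥0 q≥0 = nonNegative⁻¹ _ {{nonNeg*nonNeg⇒nonNeg p {{nonNegative p≥0}} q {{nonNegative q≥0}}}}

*-pos : ∀ {p q} → 0ℚ < p → 0ℚ < q → 0ℚ < p * q
*-pos {p} {q} p>0 q>0 = positive⁻¹ _ {{pos*pos⇒pos p {{positive p>0}} q {{positive q>0}}}}

*-monoˡ-≤-nonNeg′ : ∀ {r p q} → 0ℚ ≤ r → p ≤ q → r * p ≤ r * q
*-monoˡ-≤-nonNeg′ {r} r≥0 = *-monoˡ-≤-nonNeg r {{nonNegative r≥0}}

*-monoʳ-≤-nonNeg′ : ∀ {r p q} → 0ℚ ≤ r → p ≤ q → p * r ≤ q * r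
*-monoʳ-≤-nonNeg′ {r} r≥0 = *-monoʳ-≤-nonNeg r {{nonNegative r≥0}}

p≤p+q : ∀ p {q} → 0ℚ ≤ q → p ≤ p + q
p≤p+q p q≥0 = subst (_≤ p + _) (+-identityʳ p) (+-monoʳ-≤ p q≥0)

p≤q+p : ∀ p {q} → 0ℚ ≤ q → p ≤ q + p
p≤q+p p {q} q≥0 = subst (p ≤_) (+-comm p q) (p≤p+q p q≥0)

p-q≤p : ∀ p {q} → 0ℚ ≤ q → p - q ≤ p
p-q≤p p q≥0 = subst (p - _ ≤_) (+-identityʳ p) (+-monoʳ-≤ p (neg-antimono-≤ q≥0))

p≤q⇒0≤q-p : ∀ {p q} → p ≤ q → 0ℚ ≤ q - p
p≤q⇒0≤q-p {p} {q} p≤q = subst (_≤ q - p) (+-inverseʳ p) (+-monoˡ-≤ (- p) p≤q)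

^ℚ-nonNeg : ∀ {a} n → 0ℚ ≤ a → 0ℚ ≤ a ^ℚ n
^ℚ-nonNeg zero    a≥0 = nonNegative⁻¹ 1ℚ
^ℚ-nonNeg (suc n) a≥0 = *-nonNeg a≥0 (^ℚ-nonNeg n a≥0)

^ℚ-pos : ∀ {a} n → 0ℚ < a → 0ℚ < a ^ℚ n
^ℚ-pos zero    a>0 = positive⁻¹ 1ℚ
^ℚ-pos (suc n) a>0 = *-pos a>0 (^ℚ-pos n a>0)

^ℚ-suc-≤ : ∀ {a} n → 0ℚ ≤ a → a ≤ 1ℚ → a ^ℚ suc n ≤ a ^ℚ n
^ℚ-suc-≤ {a} n a≥0 a≤1 =
  subst (a * a ^ℚ n ≤_) (*-identityˡ (a ^ℚ n)) (*-monoʳ-≤-nonNeg′ (^ℚ-nonNeg n a≥0) a≤1)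

^ℚ-antitone : ∀ {a m n} → 0ℚ ≤ a → a ≤ 1ℚ → m ℕ.≤ n → a ^ℚ n ≤ a ^ℚ m
^ℚ-antitone {a} a≥0 a≤1 m≤n = go (ℕ.≤⇒≤′ m≤n)
  where
  go : ∀ {m n} → m ℕ.≤′ n → a ^ℚ n ≤ a ^ℚ m
  go ℕ.≤′-refl               = ≤-refl
  go (ℕ.≤′-step {n = n} m≤n) = ≤-trans (^ℚ-suc-≤ n a≥0 a≤1) (go m≤n)

bernoulli : ∀ {b} → 0ℚ ≤ b → b ≤ 1ℚ → ∀ n → (1ℚ - b) ^ℚ n * (1ℚ + fromℕ n * b) ≤ 1ℚ
bernoulli {b} b≥0 b≤1 zero =
  ≤-reflexive (solve 1 (λ b → con 1ℚ :* (con 1ℚ :+ con 0ℚ :* b) := con 1ℚ) refl b)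
bernoulli {b} b≥0 b≤1 (suc n) = begin
  (1ℚ - b) * L * (1ℚ + fromℕ (suc n) * b)
    ≡⟨ cong (λ k → (1ℚ - b) * L * (1ℚ + k * b)) (fromℕ-+ 1 n) ⟩
  (1ℚ - b) * L * (1ℚ + (1ℚ + fromℕ n) * b)
    ≡⟨ solve 3 (λ L m b → (con 1ℚ :- b) :* L :* (con 1ℚ :+ (con 1ℚ :+ m) :* b)
                        := L :* (con 1ℚ :+ m :* b) :- L :* (con 1ℚ :+ m) :* (b :* b)) refl L (fromℕ n) b ⟩
  L * (1ℚ + fromℕ n * b) - L * (1ℚ + fromℕ n) * (b * b)
    ≤⟨ p-q≤p _ (*-nonNeg (*-nonNeg L≥0 1+n≥0) (*-nonNeg b≥0 b≥0)) ⟩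
  L * (1ℚ + fromℕ n * b)
    ≤⟨ bernoulli b≥0 b≤1 n ⟩
  1ℚ ∎
  where
  open ≤-Reasoning
  L = (1ℚ - b) ^ℚ n
  L≥0 : 0ℚ ≤ L
  L≥0 = ^ℚ-nonNeg n (p≤q⇒0≤q-p b≤1)
  1+n≥0 : 0ℚ ≤ 1ℚ + fromℕ n
  1+n≥0 = +-mono-≤ (nonNegative⁻¹ 1ℚ) (fromℕ-nonNeg n)

archimedean : ∀ ε → 0ℚ < ε → ∃[ N ] 1ℚ ≤ fromℕ N * ε
archimedean (mkℚ (+ zero) _ _)   (*<* (ℤ.+<+ ()))
archimedean (mkℚ -[1+ _ ] _ _)   (*<* ())
archimedean ε@(mkℚ (+ suc p) q _) _ =
  suc q , toℚᵘ-cancel-≤ (ℚᵘ.≤-respʳ-≃ (ℚᵘ.≃-sym (toℚᵘ-homo-* (fromℕ (suc q)) ε))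
                                      (*≤* (ℤ.+≤+ q+1≤[q+1][p+1])))
  where
  q+1≤[q+1][p+1] : 1 ℕ.* (1 ℕ.* suc q) ℕ.≤ suc q ℕ.* suc p ℕ.* 1
  q+1≤[q+1][p+1] = subst₂ ℕ._≤_ (sym (trans (ℕ.*-identityˡ _) (ℕ.*-identityˡ _))) (sym (ℕ.*-identityʳ _))
                     (ℕ.m≤m*n (suc q) (suc p))

geometric-eventually-≤ : ∀ {b ε} → 0ℚ < b → b ≤ 1ℚ → 0ℚ < ε →
                         ∃[ N ] ∀ m → N ℕ.≤ m → (1ℚ - b) ^ℚ m ≤ ε
geometric-eventually-≤ {b} {ε} b>0 b≤1 ε>0 =
  let N , 1≤Nbε = archimedean (b * ε) (*-pos b>0 ε>0)
  in N , λ m N≤m →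
    let P = (1ℚ - b) ^ℚ m
        P≥0 = ^ℚ-nonNeg m (p≤q⇒0≤q-p b≤1)
        1≤mbε = ≤-trans 1≤Nbε (*-monoʳ-≤-nonNeg′ (<⇒≤ (*-pos b>0 ε>0)) (fromℕ-mono-≤ N≤m))
        P[mb]≤1 = ≤-trans (*-monoˡ-≤-nonNeg′ P≥0 (p≤q+p (fromℕ m * b) (nonNegative⁻¹ 1ℚ)))
                          (bernoulli (<⇒≤ b>0) b≤1 m)
    in begin
    P                       ≡⟨ *-identityʳ P ⟨
    P * 1ℚ                  ≤⟨ *-monoˡ-≤-nonNeg′ P≥0 1≤mbε ⟩
    P * (fromℕ m * (b * ε)) ≡⟨ solve 4 (λ P m b ε → P :* (m :* (b :* ε)) := P :* (m :* b) :* ε)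
                                       refl P (fromℕ m) b ε ⟩
    P * (fromℕ m * b) * ε   ≤⟨ *-monoʳ-≤-nonNeg′ (<⇒≤ ε>0) P[mb]≤1 ⟩
    1ℚ * ε                  ≡⟨ *-identityˡ ε ⟩
    ε                       ∎
  where open ≤-Reasoning

β α : ℚ
β = + 3 / 4
α = + 1 / 4

β≥0 : 0ℚ ≤ β
β≥0 = nonNegative⁻¹ β

α≥0 : 0ℚ ≤ α
α≥0 = nonNegative⁻¹ α

β≤1 : β ≤ 1ℚ
β≤1 = *≤* (ℤ.+≤+ (ℕ.s≤s (ℕ.s≤s (ℕ.s≤s ℕ.z≤n))))

βᵐ≤1 : ∀ m → β ^ℚ m ≤ 1ℚ
βᵐ≤1 m = ^ℚ-antitone {n = m} β≥0 β≤1 ℕ.z≤n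

weight : ℕ → ℕ → ℚ
weight y n = fromℕ (forests y n) * x₀ ^ℚ n * β ^ℚ y

weight-zero : ∀ y → weight (suc y) 0 ≡ β * weight y 0
weight-zero y rewrite forests-zero y =
  solve 1 (λ B → con (fromℕ 1) :* con 1ℚ :* (con β :* B) := con β :* (con (fromℕ 1) :* con 1ℚ :* B))
          refl (β ^ℚ y)

weight-suc : ∀ y n → weight (suc y) (suc n) ≡ β * weight y (suc n) + α * weight (4 ℕ.+ y) n
weight-suc y n = begin
  fromℕ (F₁ ℕ.+ F₂) * (x₀ * X) * (β * B)
    ≡⟨ cong (λ k → k * (x₀ * X) * (β * B)) (fromℕ-+ F₁ F₂) ⟩
  (fromℕ F₁ + fromℕ F₂) * (x₀ * X) * (β * B)
    ≡⟨ solve 4 (λ u v X B → (u :+ v) :* (con x₀ :* X) :* (con β :* B)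
                          := con β :* (u :* (con x₀ :* X) :* B)
                             :+ con α :* (v :* X :* (con β :* (con β :* (con β :* (con β :* B))))))
               refl (fromℕ F₁) (fromℕ F₂) X B ⟩
  β * weight y (suc n) + α * weight (4 ℕ.+ y) n
    ∎
  where
  open ≡-Reasoning
  F₁ = forests y (suc n)
  F₂ = forests (4 ℕ.+ y) n
  X = x₀ ^ℚ n
  B = β ^ℚ y

sumBelow : (ℕ → ℚ) → ℕ → ℚ
sumBelow f zero    = 0ℚ
sumBelow f (suc N) = sumBelow f N + f N

sumBelow-recurrence : ∀ a b {f g h} → f 0 ≡ a * g 0 → (∀ n → f (suc n) ≡ a * g (suc n) + b * h n) →
                      ∀ N → sumBelow f (suc N) ≡ a * sumBelow g (suc N) + b * sumBelow h N
sumBelow-recurrence a b {f} {g} {h} f₀ fₛ zero = begin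
  0ℚ + f 0                 ≡⟨ cong (λ k → 0ℚ + k) f₀ ⟩
  0ℚ + a * g 0             ≡⟨ solve 3 (λ a b x → con 0ℚ :+ a :* x := a :* (con 0ℚ :+ x) :+ b :* con 0ℚ)
                                        refl a b (g 0) ⟩
  a * (0ℚ + g 0) + b * 0ℚ  ∎
  where open ≡-Reasoning
sumBelow-recurrence a b {f} {g} {h} f₀ fₛ (suc N) = begin
  sumBelow f (suc N) + f (suc N)
    ≡⟨ cong₂ _+_ (sumBelow-recurrence a b f₀ fₛ N) (fₛ N) ⟩
  (a * G + b * H) + (a * g (suc N) + b * h N)
    ≡⟨ solve 6 (λ a b G H g h → (a :* G :+ b :* H) :+ (a :* g :+ b :* h) := a :* (G :+ g) :+ b :* (H :+ h))
               refl a b G H (g (suc N)) (h N) ⟩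
  a * (G + g (suc N)) + b * (H + h N) ∎
  where
  open ≡-Reasoning
  G = sumBelow g (suc N)
  H = sumBelow h N

mass : ℕ → ℕ → ℚ
mass N y = sumBelow (weight y) N

tail : ℕ → ℕ → ℚ
tail N y = 1ℚ - mass N y

tail-suc-zero : ∀ N → tail (suc N) 0 ≡ 0ℚ
tail-suc-zero N = cong (λ k → 1ℚ - k) (mass-suc-zero N)
  where
  mass-suc-zero : ∀ N → mass (suc N) 0 ≡ 1ℚ
  mass-suc-zero zero    = refl
  mass-suc-zero (suc N) = trans (cong (_+ weight 0 (suc N)) (mass-suc-zero N))
    (solve 1 (λ X → con 1ℚ :+ con (fromℕ 0) :* X :* con 1ℚ := con 1ℚ) refl (x₀ ^ℚ suc N))

tail-suc-suc : ∀ N y → tail (suc N) (suc y) ≡ β * tail (suc N) y + α * tail N (4 ℕ.+ y)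
tail-suc-suc N y = begin
  1ℚ - mass (suc N) (suc y)
    ≡⟨ cong (λ k → 1ℚ - k) (sumBelow-recurrence β α (weight-zero y) (weight-suc y) N) ⟩
  1ℚ - (β * mass (suc N) y + α * mass N (4 ℕ.+ y))
    ≡⟨ solve 2 (λ a b → con 1ℚ :- (con β :* a :+ con α :* b) := con β :* (con 1ℚ :- a) :+ con α :* (con 1ℚ :- b))
               refl (mass (suc N) y) (mass N (4 ℕ.+ y)) ⟩
  β * tail (suc N) y + α * tail N (4 ℕ.+ y) ∎
  where open ≡-Reasoning

tail-nonNeg : ∀ N y → 0ℚ ≤ tail N y
tail-nonNeg zero    y       = nonNegative⁻¹ 1ℚ
tail-nonNeg (suc N) zero    = ≤-reflexive (sym (tail-suc-zero N))
tail-nonNeg (suc N) (suc y) = subst (0ℚ ≤_) (sym (tail-suc-suc N y))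
  (+-mono-≤ (*-nonNeg β≥0 (tail-nonNeg (suc N) y)) (*-nonNeg α≥0 (tail-nonNeg N (4 ℕ.+ y))))

tail-≤1 : ∀ N y → tail N y ≤ 1ℚ
tail-≤1 zero    y       = ≤-refl
tail-≤1 (suc N) zero    = subst (_≤ 1ℚ) (sym (tail-suc-zero N)) (nonNegative⁻¹ 1ℚ)
tail-≤1 (suc N) (suc y) = subst (_≤ 1ℚ) (sym (tail-suc-suc N y))
  (+-mono-≤ (*-monoˡ-≤-nonNeg′ β≥0 (tail-≤1 (suc N) y)) (*-monoˡ-≤-nonNeg′ α≥0 (tail-≤1 N (4 ℕ.+ y))))

contraction : ℕ → ℚ
contraction M = 1ℚ - β ^ℚ M

contraction-nonNeg : ∀ M → 0ℚ ≤ contraction M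
contraction-nonNeg M = p≤q⇒0≤q-p (βᵐ≤1 M)

-- For y ≥ M the bound holds trivially as tail ≤ 1 ≤ y δ; below M, one step of the recursion in N
-- shrinks the additive constant of the bound by the factor 1 − βᴹ.
module _ {δ : ℚ} (M : ℕ) (δ≥0 : 0ℚ ≤ δ) (1≤Mδ : 1ℚ ≤ fromℕ M * δ) where

  tail-suc-≤ : ∀ {N c} → (∀ z → tail N z ≤ fromℕ z * δ + c) →
               ∀ y → tail (suc N) y ≤ fromℕ y * δ + c * (1ℚ - β ^ℚ y)
  tail-suc-≤ {N} {c} hyp zero = begin
    tail (suc N) 0               ≡⟨ tail-suc-zero N ⟩
    0ℚ                           ≡⟨ solve 2 (λ δ c → con (fromℕ 0) :* δ :+ c :* (con 1ℚ :- con 1ℚ) := con 0ℚ)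
                                            refl δ c ⟨
    fromℕ 0 * δ + c * (1ℚ - 1ℚ)  ∎
    where open ≤-Reasoning
  tail-suc-≤ {N} {c} hyp (suc y) = begin
    tail (suc N) (suc y)
      ≡⟨ tail-suc-suc N y ⟩
    β * tail (suc N) y + α * tail N (4 ℕ.+ y)
      ≤⟨ +-mono-≤ (*-monoˡ-≤-nonNeg′ β≥0 (tail-suc-≤ {N} hyp y)) (*-monoˡ-≤-nonNeg′ α≥0 (hyp (4 ℕ.+ y))) ⟩
    β * (fromℕ y * δ + c * (1ℚ - B)) + α * (fromℕ (4 ℕ.+ y) * δ + c)
      ≡⟨ cong (λ k → β * (fromℕ y * δ + c * (1ℚ - B)) + α * (k * δ + c)) (fromℕ-+ 4 y) ⟩
    β * (fromℕ y * δ + c * (1ℚ - B)) + α * ((fromℕ 4 + fromℕ y) * δ + c)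
      ≡⟨ solve 4 (λ m δ c B → con β :* (m :* δ :+ c :* (con 1ℚ :- B)) :+ con α :* ((con (fromℕ 4) :+ m) :* δ :+ c)
                            := (con (fromℕ 1) :+ m) :* δ :+ c :* (con 1ℚ :- con β :* B)) refl (fromℕ y) δ c B ⟩
    (fromℕ 1 + fromℕ y) * δ + c * (1ℚ - β * B)
      ≡⟨ cong (λ k → k * δ + c * (1ℚ - β * B)) (fromℕ-+ 1 y) ⟨
    fromℕ (suc y) * δ + c * (1ℚ - β ^ℚ suc y)
      ∎
    where
    open ≤-Reasoning
    B = β ^ℚ y

  tail-≤-contraction : ∀ {N c} → 0ℚ ≤ c → (∀ y → tail N y ≤ fromℕ y * δ + c * (1ℚ - β ^ℚ y)) →
                       ∀ y → tail N y ≤ fromℕ y * δ + contraction M * c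
  tail-≤-contraction {N} {c} c≥0 hyp y with ℕ.≤-total M y
  ... | inj₁ M≤y = begin
    tail N y                         ≤⟨ tail-≤1 N y ⟩
    1ℚ                               ≤⟨ 1≤Mδ ⟩
    fromℕ M * δ                      ≤⟨ *-monoʳ-≤-nonNeg′ δ≥0 (fromℕ-mono-≤ M≤y) ⟩
    fromℕ y * δ                      ≤⟨ p≤p+q _ (*-nonNeg (contraction-nonNeg M) c≥0) ⟩
    fromℕ y * δ + contraction M * c  ∎
    where open ≤-Reasoning
  ... | inj₂ y≤M = begin
    tail N y                         ≤⟨ hyp y ⟩
    fromℕ y * δ + c * (1ℚ - β ^ℚ y)  ≤⟨ +-monoʳ-≤ (fromℕ y * δ) (*-monoˡ-≤-nonNeg′ c≥0 1-βʸ≤1-βᴹ) ⟩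
    fromℕ y * δ + c * contraction M  ≡⟨ cong (λ k → fromℕ y * δ + k) (*-comm c (contraction M)) ⟩
    fromℕ y * δ + contraction M * c  ∎
    where
    open ≤-Reasoning
    1-βʸ≤1-βᴹ : 1ℚ - β ^ℚ y ≤ contraction M
    1-βʸ≤1-βᴹ = +-monoʳ-≤ 1ℚ (neg-antimono-≤ (^ℚ-antitone β≥0 β≤1 y≤M))

  tail-bound : ∀ N y → tail N y ≤ fromℕ y * δ + contraction M ^ℚ N
  tail-bound zero    y = p≤q+p 1ℚ (*-nonNeg (fromℕ-nonNeg y) δ≥0)
  tail-bound (suc N) y =
    tail-≤-contraction {suc N} (^ℚ-nonNeg N (contraction-nonNeg M)) (tail-suc-≤ {N} (tail-bound N)) y

tail-eventually-≤ : ∀ Y {ε} → 0ℚ < ε → ∃[ N ] ∀ m → N ℕ.≤ m → ∀ y → y ℕ.≤ Y → tail m y ≤ ε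
tail-eventually-≤ Y {ε} ε>0 =
  let M , 1≤Mδ = archimedean δ δ>0
      N , contractionᵐ≤ε/2 = geometric-eventually-≤ (^ℚ-pos M (positive⁻¹ β)) (βᵐ≤1 M) ε/2>0
  in N , λ m N≤m y y≤Y → begin
    tail m y                          ≤⟨ tail-bound M (<⇒≤ δ>0) 1≤Mδ m y ⟩
    fromℕ y * δ + contraction M ^ℚ m  ≤⟨ +-mono-≤ (yδ≤ε/2 y≤Y) (contractionᵐ≤ε/2 m N≤m) ⟩
    ε * ½ + ε * ½                     ≡⟨ solve 1 (λ ε → ε :* con ½ :+ ε :* con ½ := ε) refl ε ⟩
    ε                                 ∎
  where
  open ≤-Reasoning
  t = 1/ fromℕ (suc Y)
  t>0 : 0ℚ < t
  t>0 = positive⁻¹ t {{1/pos⇒pos (fromℕ (suc Y))}}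
  ε/2>0 : 0ℚ < ε * ½
  ε/2>0 = *-pos ε>0 (positive⁻¹ ½)
  δ = ε * ½ * t
  δ>0 : 0ℚ < δ
  δ>0 = *-pos ε/2>0 t>0
  yδ≤ε/2 : ∀ {y} → y ℕ.≤ Y → fromℕ y * δ ≤ ε * ½
  yδ≤ε/2 {y} y≤Y = begin
    fromℕ y * (ε * ½ * t)        ≡⟨ solve 3 (λ m e t → m :* (e :* t) := e :* (m :* t)) refl (fromℕ y) (ε * ½) t ⟩
    ε * ½ * (fromℕ y * t)        ≤⟨ *-monoˡ-≤-nonNeg′ (<⇒≤ ε/2>0)
                                       (*-monoʳ-≤-nonNeg′ (<⇒≤ t>0) (fromℕ-mono-≤ (ℕ.m≤n⇒m≤1+n y≤Y))) ⟩
    ε * ½ * (fromℕ (suc Y) * t)  ≡⟨ cong (ε * ½ *_) (*-inverseʳ (fromℕ (suc Y))) ⟩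
    ε * ½ * 1ℚ                   ≡⟨ *-identityʳ (ε * ½) ⟩
    ε * ½                        ∎

-- c₂ = 2 / β² and c₃ = 1 / β³.
c₂ c₃ : ℚ
c₂ = + 32 / 9
c₃ = + 64 / 27

coeff-forests : ∀ n → coeff n ≡ fromℕ (2 ℕ.* forests 2 n) - fromℕ (forests 3 n)
coeff-forests n = /-as-difference _ (forests 3 n) (2 ℕ.* forests 2 n) _ {{(n ℕ.+ 1) ℕ.!* (3 ℕ.* n ℕ.+ 2) !≢0}}
                    (coeff-numerator n)

coeff-term : ∀ n → coeff n * x₀ ^ℚ n ≡ c₂ * weight 2 n - c₃ * weight 3 n
coeff-term n = begin
  coeff n * X
    ≡⟨ cong (_* X) (coeff-forests n) ⟩
  (fromℕ (2 ℕ.* F₂) - fromℕ F₃) * X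
    ≡⟨ cong (λ k → (k - fromℕ F₃) * X) (fromℕ-* 2 F₂) ⟩
  (fromℕ 2 * fromℕ F₂ - fromℕ F₃) * X
    ≡⟨ solve 3 (λ u v X → (con (fromℕ 2) :* u :- v) :* X
                        := con c₂ :* (u :* X :* (con β :* (con β :* con 1ℚ)))
                           :- con c₃ :* (v :* X :* (con β :* (con β :* (con β :* con 1ℚ)))))
               refl (fromℕ F₂) (fromℕ F₃) X ⟩
  c₂ * weight 2 n - c₃ * weight 3 n
    ∎
  where
  open ≡-Reasoning
  F₂ = forests 2 n
  F₃ = forests 3 n
  X = x₀ ^ℚ n

partialSum-error : ∀ N → partialSum x₀ N - + 5 / 27 ≡ c₃ * tail (suc N) 3 - c₂ * tail (suc N) 2
partialSum-error zero    = refl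
partialSum-error (suc N) = begin
  (partialSum x₀ N + T) - + 5 / 27
    ≡⟨ solve 3 (λ s t l → (s :+ t) :- l := (s :- l) :+ t) refl (partialSum x₀ N) T (+ 5 / 27) ⟩
  (partialSum x₀ N - + 5 / 27) + T
    ≡⟨ cong₂ _+_ (partialSum-error N) (coeff-term (suc N)) ⟩
  (c₃ * (1ℚ - m₃) - c₂ * (1ℚ - m₂)) + (c₂ * w₂ - c₃ * w₃)
    ≡⟨ solve 6 (λ c₂ c₃ m₂ m₃ w₂ w₃ → (c₃ :* (con 1ℚ :- m₃) :- c₂ :* (con 1ℚ :- m₂)) :+ (c₂ :* w₂ :- c₃ :* w₃)
                                    := c₃ :* (con 1ℚ :- (m₃ :+ w₃)) :- c₂ :* (con 1ℚ :- (m₂ :+ w₂)))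
               refl c₂ c₃ m₂ m₃ w₂ w₃ ⟩
  c₃ * (1ℚ - (m₃ + w₃)) - c₂ * (1ℚ - (m₂ + w₂)) ∎
  where
  open ≡-Reasoning
  T = coeff (suc N) * x₀ ^ℚ suc N
  m₂ = mass (suc N) 2
  m₃ = mass (suc N) 3
  w₂ = weight 2 (suc N)
  w₃ = weight 3 (suc N)

∣ax-by∣≤[a+b]e : ∀ {a b x y e} → 0ℚ ≤ a → 0ℚ ≤ b → 0ℚ ≤ x → x ≤ e → 0ℚ ≤ y → y ≤ e →
                 ∣ a * x - b * y ∣ ≤ (a + b) * e
∣ax-by∣≤[a+b]e {a} {b} {x} {y} {e} a≥0 b≥0 x≥0 x≤e y≥0 y≤e = begin
  ∣ a * x - b * y ∣      ≤⟨ ∣p-q∣≤∣p∣+∣q∣ (a * x) (b * y) ⟩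
  ∣ a * x ∣ + ∣ b * y ∣  ≡⟨ cong₂ _+_ (0≤p⇒∣p∣≡p (*-nonNeg a≥0 x≥0))
                                       (0≤p⇒∣p∣≡p (*-nonNeg b≥0 y≥0)) ⟩
  a * x + b * y          ≤⟨ +-mono-≤ (*-monoˡ-≤-nonNeg′ a≥0 x≤e) (*-monoˡ-≤-nonNeg′ b≥0 y≤e) ⟩
  a * e + b * e          ≡⟨ *-distribʳ-+ e a b ⟨
  (a + b) * e            ∎
  where open ≤-Reasoning

partialSum-close : ∀ {ε N} → 0ℚ < ε → (∀ m → N ℕ.≤ m → ∀ y → y ℕ.≤ 3 → tail m y ≤ ε * (+ 1 / 8)) →
                   ∀ m → N ℕ.≤ m → ∣ partialSum x₀ m - + 5 / 27 ∣ < ε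
partialSum-close {ε} ε>0 small m N≤m = begin-strict
  ∣ partialSum x₀ m - + 5 / 27 ∣  ≡⟨ cong ∣_∣ (partialSum-error m) ⟩
  ∣ c₃ * T₃ - c₂ * T₂ ∣           ≤⟨ ∣ax-by∣≤[a+b]e (nonNegative⁻¹ c₃) (nonNegative⁻¹ c₂)
                                       (tail-nonNeg (suc m) 3) (small (suc m) N≤1+m 3 ℕ.≤-refl)
                                       (tail-nonNeg (suc m) 2) (small (suc m) N≤1+m 2 (ℕ.n≤1+n 2)) ⟩
  (c₃ + c₂) * (ε * (+ 1 / 8))     ≡⟨ solve 1 (λ ε → (con c₃ :+ con c₂) :* (ε :* con (+ 1 / 8)) := con (+ 20 / 27) :* ε)
                                              refl ε ⟩
  (+ 20 / 27) * ε                 <⟨ *-monoˡ-<-pos ε {{positive ε>0}} (toWitness {a? = + 20 / 27 <? 1ℚ} _) ⟩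
  1ℚ * ε                          ≡⟨ *-identityˡ ε ⟩
  ε                               ∎
  where
  open ≤-Reasoning
  N≤1+m = ℕ.m≤n⇒m≤1+n N≤m
  T₂ = tail (suc m) 2
  T₃ = tail (suc m) 3

mainTheorem4 : ConvergesTo (partialSum x₀) (+ 5 / 27)
mainTheorem4 ε ε>0 =
  let N , small = tail-eventually-≤ 3 (*-pos ε>0 (positive⁻¹ (+ 1 / 8)))
  in N , partialSum-close ε>0 small
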